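{- Let $G$ be a finite group of order $n>132$. Then $\mathcal{Z}_{\mathrm{HS}}(G)\cup\mathcal{Z}_{\mathrm{HC}}(G)=\emptyset$.
   Context: For a finite group $G$ and $S\subseteq G$, the Haar graph $\mathrm{H}(G,S)$ has vertex set $G\times\{1,2\}$, with $(g,1)\sim(h,2)$ iff $hg^{ -1}\in S$; $G$ is identified with the automorphism group $\{(g,i)\mapsto(gx,i):x\in G\}$, and $\mathrm{Aut}^+(\mathrm{H}(G,S))$ is the subgroup of automorphisms fixing $G\times\{1\}$ and $G\times\{2\}$ setwise. With $|G|=n$, a $0.1$-critical pair $(S,M)$ consists of $S\subseteq G$ and $M\leq\mathrm{Aut}^+(\mathrm{H}(G,S))$ such that $G$ is a maximal proper subgroup of $M$, $|M|>2^{n^{0.4}+\log_2n}$, and $\mathrm{Core}_M(G)=1$; then $M$ acts faithfully and primitively by right multiplication on the set $[M:G]$ of right cosets of $G$. For an O'Nan–Scott type $\mathcal{T}$ among the eight types HA, HS, HC, AS, SD, CD, TW, PA of finite primitive groups (in Praeger's division), $\mathcal{Z}_{\mathcal{T}}(G)$ is the set of $S\subseteq G$ for which there exists a $0.1$-critical pair $(S,M)$ such that the action of $M$ on $[M:G]$ is primitive of type $\mathcal{T}$. -}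

module Defs where

open import Data.Nat using (ℕ; zero; suc; _+_; _*_; _^_; _≤_; _<_)
open import Data.Fin using (Fin; zero; suc)
open import Data.Fin.Subset using (Subset; _∈_; _∉_; _⊆_)
open import Data.Product using (Σ; ∃; ∃-syntax; _×_; _,_)
open import Data.Sum using (_⊎_)
open import Relation.Nullary using (¬_)
open import Relation.Binary.PropositionalEquality using (_≡_; _≢_)

-- Finite groups: a group of order n, realised on the carrier Fin n.
-- (Every finite group of order n is isomorphic to one of these.)

record FinGroup (n : ℕ) : Set where
  field
    _·_   : Fin n → Fin n → Fin n
    e     : Fin n
    inv   : Fin n → Fin n
    assoc : ∀ x y z → (x · y) · z ≡ x · (y · z)
    idˡ   : ∀ x → e · x ≡ x
    idʳ   : ∀ x → x · e ≡ x
    invˡ  : ∀ x → inv x · x ≡ e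
    invʳ  : ∀ x → x · inv x ≡ e

module _ {m : ℕ} (M : FinGroup m) where
  open FinGroup M

  IsSubgroup : Subset m → Set
  IsSubgroup H = (e ∈ H) × (∀ x y → x ∈ H → y ∈ H → (x · y) ∈ H)
                 × (∀ x → x ∈ H → inv x ∈ H)

  IsNormal : Subset m → Set
  IsNormal N = IsSubgroup N × (∀ x y → x ∈ N → ((y · x) · inv y) ∈ N)

  Trivial : Subset m → Set
  Trivial H = ∀ x → x ∈ H → x ≡ e

  IsMinimalNormal : Subset m → Set
  IsMinimalNormal N = IsNormal N × ¬ Trivial N
    × (∀ K → IsNormal K → K ⊆ N → Trivial K ⊎ N ⊆ K)

  IsAbelianSet : Subset m → Set
  IsAbelianSet N = ∀ x y → x ∈ N → y ∈ N → x · y ≡ y · x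

  IsSimpleSub : Subset m → Set
  IsSimpleSub N = ¬ Trivial N
    × (∀ K → IsSubgroup K → K ⊆ N
         → (∀ x y → x ∈ N → y ∈ K → ((x · y) · inv x) ∈ K)
         → Trivial K ⊎ N ⊆ K)

  -- A point stabiliser of the action on right cosets [M:H] is H itself,
  -- where H = image of ι. N acts regularly on [M:H] iff N is transitive
  -- (M = H N) and the stabiliser N ∩ H is trivial (N normal).
  module _ {n : ℕ} (ι : Fin n → Fin m) where
    InImage : Fin m → Set
    InImage x = ∃[ g ] ι g ≡ x

    RegularOnCosets : Subset m → Set
    RegularOnCosets N = (∀ x → ∃[ g ] ∃[ y ] (y ∈ N × x ≡ ι g · y))
                      × (∀ y → y ∈ N → InImage y → y ≡ e)

    TwoMinNormal : (Subset m → Set) → Set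
    TwoMinNormal P = ∃[ N₁ ] ∃[ N₂ ]
        ( N₁ ≢ N₂
        × IsMinimalNormal N₁ × IsMinimalNormal N₂
        × (∀ K → IsMinimalNormal K → K ≡ N₁ ⊎ K ≡ N₂)
        × ¬ IsAbelianSet N₁ × ¬ IsAbelianSet N₂
        × RegularOnCosets N₁ × RegularOnCosets N₂
        × P N₁ × P N₂ )

    TypeHS : Set
    TypeHS = TwoMinNormal IsSimpleSub

    -- O'Nan–Scott type HC: two minimal normal subgroups, each ≅ T^k, k ≥ 2
    -- (a nonabelian minimal normal subgroup is T^k; k ≥ 2 iff not simple)
    TypeHC : Set
    TypeHC = TwoMinNormal (λ N → ¬ IsSimpleSub N)

data OSType : Set where
  HS HC : OSType

HasType : OSType → ∀ {m n} (M : FinGroup m) (ι : Fin n → Fin m) → Set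
HasType HS M ι = TypeHS M ι
HasType HC M ι = TypeHC M ι

-- Haar graph H(G,S): (g,1) ~ (h,2) iff h g⁻¹ ∈ S.
-- Sides: zero = G×{1}, suc zero = G×{2}.

side₁ side₂ : Fin 2
side₁ = zero
side₂ = suc zero

HaarAdj : ∀ {n} (G : FinGroup n) → Subset n → Fin n → Fin n → Set
HaarAdj G S g h = (h · inv g) ∈ S
  where open FinGroup G

-- |M| > 2^(n^0.4 + log₂ n) = n · 2^(n^(2/5)), with m = |M|.
-- Stated over ℕ: there is a rational a/b (b ≥ 1) with
--   n^(2/5) < a/b   (i.e. n²·b⁵ < a⁵)   and   2^(a/b) ≤ m/n  (i.e. 2^a·n^b ≤ m^b).
BigOrder : ℕ → ℕ → Set
BigOrder n m = ∃[ a ] ∃[ b ] (1 ≤ b × (n ^ 2) * (b ^ 5) < a ^ 5 × (2 ^ a) * (n ^ b) ≤ m ^ b)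

-- M is an abstract finite group of order m acting faithfully (on the right)
-- on the vertex set G × {1,2}, preserving each side and the Haar adjacency
-- (so M is identified with a subgroup of Aut⁺(H(G,S))); ι : G → M is a
-- homomorphism whose action is right translation, i.e. ι identifies G with
-- the subgroup {(g,i) ↦ (gx,i)} of M.

module _ {n : ℕ} (G : FinGroup n) where
  private module G' = FinGroup G

  record CriticalPair (S : Subset n) (T : OSType) : Set where
    field
      m     : ℕ
      M     : FinGroup m
      act   : Fin m → Fin 2 → Fin n → Fin n
      ι     : Fin n → Fin m
    open FinGroup M
    field
      act-e    : ∀ i g → act e i g ≡ g
      act-·    : ∀ x y i g → act (x · y) i g ≡ act y i (act x i g)
      faithful : ∀ x → (∀ i g → act x i g ≡ g) → x ≡ e
      preserves : ∀ x g h → (HaarAdj G S g h → HaarAdj G S (act x side₁ g) (act x side₂ h))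
                          × (HaarAdj G S (act x side₁ g) (act x side₂ h) → HaarAdj G S g h)
      ι-hom    : ∀ g h → ι (g G'.· h) ≡ ι g · ι h
      ι-trans  : ∀ g i x → act (ι x) i g ≡ g G'.· x
      proper   : ∃[ x ] ¬ InImage M ι x
      maximal  : ∀ H → IsSubgroup M H → (∀ g → ι g ∈ H)
                 → (∀ x → x ∈ H → InImage M ι x) ⊎ (∀ x → x ∈ H)
      big      : BigOrder n m
      corefree : ∀ x → (∀ y → InImage M ι ((y · x) · inv y)) → x ≡ e
      type     : HasType T M ι

  𝒵 : OSType → Subset n → Set
  𝒵 T S = CriticalPair S T

-- In types HS and HC the group M has two distinct minimal normal subgroups N₁, N₂, each
-- transitive on [M:G], i.e. M = G Nᵢ. Distinct minimal normal subgroups meet trivially, so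
-- x ↦ (g₁, g₂) with x ∈ gᵢ Nᵢ embeds M into G × G and |M| ≤ n². On the other hand
-- 2^(n^0.4 + log₂ n) = n · 2^(n^0.4) ≥ n² as soon as log₂ n ≤ n^0.4, which holds for n > 132;
-- this is certified by a rational p/q with log₂ n ≤ p/q ≤ n^0.4, fixed on each of finitely
-- many intervals and, for n ≥ 256, the integer p with 2^(p-1) ≤ n ≤ 2^p.
module Submission where

open import Defs
open import Level using (0ℓ)
open import Algebra.Bundles using (Group)
open import Data.Nat
open import Data.Nat.Properties
open import Data.Nat.Solver using (module +-*-Solver)
open import Data.Fin using (Fin; combine)
open import Data.Fin.Properties using (injective⇒≤; combine-injective)
open import Data.Fin.Subset using (Subset; _∈_; _∩_)
open import Data.Fin.Subset.Properties using (x∈p∩q⁺; x∈p∩q⁻; p∩q⊆p; p∩q⊆q; ⊆-trans; ⊆-antisym)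
open import Data.Product using (∃-syntax; _×_; _,_; proj₁)
open import Data.Sum using (_⊎_; inj₁; inj₂; [_,_])
open import Data.Unit using (tt)
open import Data.Empty using (⊥-elim)
open import Relation.Nullary using (¬_; yes; no)
open import Relation.Binary.PropositionalEquality
  using (_≡_; _≢_; refl; sym; trans; cong; cong₂; subst; subst₂; isEquivalence; module ≡-Reasoning)

module _ {m : ℕ} (M : FinGroup m) where
  open FinGroup M

  group : Group 0ℓ 0ℓ
  group = record
    { Carrier = Fin m ; _≈_ = _≡_ ; _∙_ = _·_ ; ε = e ; _⁻¹ = inv
    ; isGroup = record
      { isMonoid = record
        { isSemigroup = record
          { isMagma = record { isEquivalence = isEquivalence ; ∙-cong = cong₂ _·_ }
          ; assoc = assoc }
        ; identity = idˡ , idʳ }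
      ; inverse = invˡ , invʳ
      ; ⁻¹-cong = cong inv } }

  open import Algebra.Properties.Group group using (\\-leftDividesˡ; ∙-cancelˡ)

  ∩-isNormal : ∀ {N₁ N₂} → IsNormal M N₁ → IsNormal M N₂ → IsNormal M (N₁ ∩ N₂)
  ∩-isNormal {N₁} {N₂} ((e₁ , ·₁ , inv₁) , conj₁) ((e₂ , ·₂ , inv₂) , conj₂) =
    (x∈p∩q⁺ (e₁ , e₂) , ·∩ , inv∩) , conj∩
    where
    ·∩ : ∀ x y → x ∈ N₁ ∩ N₂ → y ∈ N₁ ∩ N₂ → x · y ∈ N₁ ∩ N₂
    ·∩ x y x∈ y∈ with x∈p∩q⁻ N₁ N₂ x∈ | x∈p∩q⁻ N₁ N₂ y∈
    ... | x₁ , x₂ | y₁ , y₂ = x∈p∩q⁺ (·₁ x y x₁ y₁ , ·₂ x y x₂ y₂)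
    inv∩ : ∀ x → x ∈ N₁ ∩ N₂ → inv x ∈ N₁ ∩ N₂
    inv∩ x x∈ with x∈p∩q⁻ N₁ N₂ x∈
    ... | x₁ , x₂ = x∈p∩q⁺ (inv₁ x x₁ , inv₂ x x₂)
    conj∩ : ∀ x y → x ∈ N₁ ∩ N₂ → (y · x) · inv y ∈ N₁ ∩ N₂
    conj∩ x y x∈ with x∈p∩q⁻ N₁ N₂ x∈
    ... | x₁ , x₂ = x∈p∩q⁺ (conj₁ x y x₁ , conj₂ x y x₂)

  minimalNormal-∩-trivial : ∀ {N₁ N₂} → N₁ ≢ N₂ → IsMinimalNormal M N₁ → IsMinimalNormal M N₂
    → Trivial M (N₁ ∩ N₂)
  minimalNormal-∩-trivial {N₁} {N₂} N₁≢N₂ (N₁◁M , N₁≢1 , min₁) (N₂◁M , _ , min₂)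
    with min₁ (N₁ ∩ N₂) (∩-isNormal N₁◁M N₂◁M) (p∩q⊆p N₁ N₂)
  ... | inj₁ N₁∩N₂≡1 = N₁∩N₂≡1
  ... | inj₂ N₁⊆N₁∩N₂ with min₂ N₁ N₁◁M (⊆-trans N₁⊆N₁∩N₂ (p∩q⊆q N₁ N₂))
  ...   | inj₁ N₁≡1 = ⊥-elim (N₁≢1 N₁≡1)
  ...   | inj₂ N₂⊆N₁ = ⊥-elim (N₁≢N₂ (⊆-antisym (⊆-trans N₁⊆N₁∩N₂ (p∩q⊆q N₁ N₂)) N₂⊆N₁))

  sameCoset⇒∈xN : ∀ {N} → IsSubgroup M N → ∀ {h x x' y y'} → y ∈ N → y' ∈ N
    → x ≡ h · y → x' ≡ h · y' → ∃[ z ] (z ∈ N × x' ≡ x · z)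
  sameCoset⇒∈xN {N} (_ , ·-closed , inv-closed) {h} {x} {x'} {y} {y'} y∈N y'∈N refl refl =
    inv y · y' , ·-closed _ _ (inv-closed y y∈N) y'∈N , (begin
      h · y'                 ≡⟨ cong (h ·_) (\\-leftDividesˡ y y') ⟨
      h · (y · (inv y · y')) ≡⟨ assoc h y _ ⟨
      (h · y) · (inv y · y') ∎)
    where open ≡-Reasoning

  ∈xN₁∩xN₂⇒≡ : ∀ {N₁ N₂} → Trivial M (N₁ ∩ N₂) → ∀ {x x' z₁ z₂} → z₁ ∈ N₁ → z₂ ∈ N₂
    → x' ≡ x · z₁ → x' ≡ x · z₂ → x ≡ x'
  ∈xN₁∩xN₂⇒≡ N₁∩N₂≡1 {x} {x'} {z₁} {z₂} z₁∈N₁ z₂∈N₂ x'≡xz₁ x'≡xz₂ = begin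
    x      ≡⟨ idʳ x ⟨
    x · e  ≡⟨ cong (x ·_) z₁≡e ⟨
    x · z₁ ≡⟨ x'≡xz₁ ⟨
    x'     ∎
    where
    open ≡-Reasoning
    z₁≡z₂ : z₁ ≡ z₂
    z₁≡z₂ = ∙-cancelˡ x z₁ z₂ (trans (sym x'≡xz₁) x'≡xz₂)
    z₁≡e : z₁ ≡ e
    z₁≡e = N₁∩N₂≡1 z₁ (x∈p∩q⁺ (z₁∈N₁ , subst (_∈ _) (sym z₁≡z₂) z₂∈N₂))

  module _ {n : ℕ} (ι : Fin n → Fin m) where

    TransitiveOnCosets : Subset m → Set
    TransitiveOnCosets N = ∀ x → ∃[ g ] ∃[ y ] (y ∈ N × x ≡ ι g · y)

    transitiveSubgroups-∩-trivial⇒m≤n*n : ∀ {N₁ N₂} → IsSubgroup M N₁ → IsSubgroup M N₂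
      → Trivial M (N₁ ∩ N₂) → TransitiveOnCosets N₁ → TransitiveOnCosets N₂ → m ≤ n * n
    transitiveSubgroups-∩-trivial⇒m≤n*n {N₁} {N₂} N₁≤M N₂≤M N₁∩N₂≡1 M≡GN₁ M≡GN₂ =
      injective⇒≤ {f = λ x → combine (proj₁ (M≡GN₁ x)) (proj₁ (M≡GN₂ x))} injective
      where
      injective : ∀ {x x'} → combine (proj₁ (M≡GN₁ x)) (proj₁ (M≡GN₂ x))
                           ≡ combine (proj₁ (M≡GN₁ x')) (proj₁ (M≡GN₂ x')) → x ≡ x'
      injective {x} {x'} eq with M≡GN₁ x | M≡GN₂ x | M≡GN₁ x' | M≡GN₂ x'
      ... | g₁ , y₁ , y₁∈ , x≡ | g₂ , y₂ , y₂∈ , x≡' | g₁' , y₁' , y₁'∈ , x'≡ | g₂' , y₂' , y₂'∈ , x'≡'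
        with combine-injective g₁ g₂ g₁' g₂' eq
      ... | refl , refl with sameCoset⇒∈xN N₁≤M y₁∈ y₁'∈ x≡ x'≡ | sameCoset⇒∈xN N₂≤M y₂∈ y₂'∈ x≡' x'≡'
      ... | z₁ , z₁∈ , x'≡xz₁ | z₂ , z₂∈ , x'≡xz₂ = ∈xN₁∩xN₂⇒≡ N₁∩N₂≡1 z₁∈ z₂∈ x'≡xz₁ x'≡xz₂

    twoMinNormal⇒m≤n*n : ∀ {P} → TwoMinNormal M ι P → m ≤ n * n
    twoMinNormal⇒m≤n*n (_ , _ , N₁≢N₂ , N₁-min@((N₁◁M , _) , _) , N₂-min@((N₂◁M , _) , _)
                       , _ , _ , _ , (M≡GN₁ , _) , (M≡GN₂ , _) , _) =
      transitiveSubgroups-∩-trivial⇒m≤n*n N₁◁M N₂◁M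
        (minimalNormal-∩-trivial N₁≢N₂ N₁-min N₂-min) M≡GN₁ M≡GN₂

open +-*-Solver

^-distribʳ-* : ∀ x y k → (x * y) ^ k ≡ x ^ k * y ^ k
^-distribʳ-* x y zero = refl
^-distribʳ-* x y (suc k) rewrite ^-distribʳ-* x y k =
  solve 4 (λ x y X Y → (x :* y) :* (X :* Y) := (x :* X) :* (y :* Y)) refl x y (x ^ k) (y ^ k)

^-cancelʳ-≤ : ∀ b → 1 < b → ∀ {x y} → b ^ x ≤ b ^ y → x ≤ y
^-cancelʳ-≤ b 1<b bˣ≤bʸ = ≮⇒≥ (λ y<x → <⇒≱ (^-monoʳ-< b 1<b y<x) bˣ≤bʸ)

-- A rational p/q with log₂ n ≤ p/q ≤ n^(2/5), with both inequalities raised to integral powers.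
LogBelowRoot : ℕ → Set
LogBelowRoot n = ∃[ p ] ∃[ q ] (1 ≤ q × n ^ q ≤ 2 ^ p × p ^ 5 ≤ n ^ 2 * q ^ 5)

2^a≤n^b⇒a⁵≤n²b⁵ : ∀ {n a b} → LogBelowRoot n → 2 ^ a ≤ n ^ b → a ^ 5 ≤ n ^ 2 * b ^ 5
2^a≤n^b⇒a⁵≤n²b⁵ {n} {a} {b} (p , q , 1≤q , nᵠ≤2ᵖ , p⁵≤n²q⁵) 2ᵃ≤nᵇ =
  *-cancelʳ-≤ (a ^ 5) (n ^ 2 * b ^ 5) (q ^ 5) {{m^n≢0 q 5 {{>-nonZero 1≤q}}}} (begin
    a ^ 5 * q ^ 5         ≡⟨ ^-distribʳ-* a q 5 ⟨
    (a * q) ^ 5           ≤⟨ ^-monoˡ-≤ 5 aq≤pb ⟩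
    (p * b) ^ 5           ≡⟨ ^-distribʳ-* p b 5 ⟩
    p ^ 5 * b ^ 5         ≤⟨ *-monoˡ-≤ (b ^ 5) p⁵≤n²q⁵ ⟩
    n ^ 2 * q ^ 5 * b ^ 5 ≡⟨ solve 3 (λ N Q B → N :* Q :* B := N :* B :* Q) refl (n ^ 2) (q ^ 5) (b ^ 5) ⟩
    n ^ 2 * b ^ 5 * q ^ 5 ∎)
  where
  open ≤-Reasoning
  aq≤pb : a * q ≤ p * b
  aq≤pb = ^-cancelʳ-≤ 2 (s≤s (s≤s z≤n)) (begin
    2 ^ (a * q)   ≡⟨ ^-*-assoc 2 a q ⟨
    (2 ^ a) ^ q   ≤⟨ ^-monoˡ-≤ q 2ᵃ≤nᵇ ⟩
    (n ^ b) ^ q   ≡⟨ ^-*-assoc n b q ⟩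
    n ^ (b * q)   ≡⟨ cong (n ^_) (*-comm b q) ⟩
    n ^ (q * b)   ≡⟨ ^-*-assoc n q b ⟨
    (n ^ q) ^ b   ≤⟨ ^-monoˡ-≤ b nᵠ≤2ᵖ ⟩
    (2 ^ p) ^ b   ≡⟨ ^-*-assoc 2 p b ⟩
    2 ^ (p * b)   ∎)

logBelowRoot-interval : ∀ L U p q {n} → L ≤ n → n ≤ U → 1 ≤ q
  → U ^ q ≤ 2 ^ p → p ^ 5 ≤ L ^ 2 * q ^ 5 → LogBelowRoot n
logBelowRoot-interval L U p q L≤n n≤U 1≤q Uᵠ≤2ᵖ p⁵≤L²q⁵ =
  p , q , 1≤q , ≤-trans (^-monoˡ-≤ q n≤U) Uᵠ≤2ᵖ , ≤-trans p⁵≤L²q⁵ (*-monoˡ-≤ (q ^ 5) (^-monoˡ-≤ 2 L≤n))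

[1+x]⁵≤4x⁵ : ∀ x → 9 ≤ x → suc x ^ 5 ≤ 4 * x ^ 5
[1+x]⁵≤4x⁵ x 9≤x = *-cancelˡ-≤ (9 ^ 5) (begin
    9 ^ 5 * suc x ^ 5   ≡⟨ ^-distribʳ-* 9 (suc x) 5 ⟨
    (9 * suc x) ^ 5     ≤⟨ ^-monoˡ-≤ 5 9[1+x]≤10x ⟩
    (10 * x) ^ 5        ≡⟨ ^-distribʳ-* 10 x 5 ⟩
    10 ^ 5 * x ^ 5      ≤⟨ *-monoˡ-≤ (x ^ 5) (≤ᵇ⇒≤ (10 ^ 5) (9 ^ 5 * 4) tt) ⟩
    9 ^ 5 * 4 * x ^ 5   ≡⟨ *-assoc (9 ^ 5) 4 (x ^ 5) ⟩
    9 ^ 5 * (4 * x ^ 5) ∎)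
  where
  open ≤-Reasoning
  9[1+x]≤10x : 9 * suc x ≤ 10 * x
  9[1+x]≤10x = subst₂ _≤_ (solve 1 (λ x → con 9 :+ con 9 :* x := con 9 :* (con 1 :+ x)) refl x)
                          (solve 1 (λ x → x :+ con 9 :* x := con 10 :* x) refl x)
                          (+-monoˡ-≤ (9 * x) 9≤x)

[k+9]⁵≤2^[k+8]*2^[k+8] : ∀ k → (k + 9) ^ 5 ≤ 2 ^ (k + 8) * 2 ^ (k + 8)
[k+9]⁵≤2^[k+8]*2^[k+8] zero = ≤ᵇ⇒≤ _ _ tt
[k+9]⁵≤2^[k+8]*2^[k+8] (suc k) = begin
    suc (k + 9) ^ 5   ≤⟨ [1+x]⁵≤4x⁵ (k + 9) (m≤n+m 9 k) ⟩
    4 * (k + 9) ^ 5   ≤⟨ *-monoʳ-≤ 4 ([k+9]⁵≤2^[k+8]*2^[k+8] k) ⟩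
    4 * (X * X)       ≡⟨ solve 1 (λ X → con 4 :* (X :* X) := (con 2 :* X) :* (con 2 :* X)) refl X ⟩
    (2 * X) * (2 * X) ∎
  where
  open ≤-Reasoning
  X = 2 ^ (k + 8)

n<2^n : ∀ n → n < 2 ^ n
n<2^n zero = s≤s z≤n
n<2^n (suc n) = begin-strict
  suc n         ≡⟨ +-comm 1 n ⟩
  n + 1         <⟨ +-mono-<-≤ (n<2^n n) (m^n>0 2 n) ⟩
  2 ^ n + 2 ^ n ≡⟨ cong (2 ^ n +_) (+-identityʳ (2 ^ n)) ⟨
  2 * 2 ^ n     ∎
  where open ≤-Reasoning

dyadicInterval : ∀ {n} → 256 ≤ n → ∃[ k ] (2 ^ (k + 8) ≤ n × n ≤ 2 ^ (k + 9))
dyadicInterval {n} 256≤n = search n (≤-trans (<⇒≤ (n<2^n n)) (^-monoʳ-≤ 2 (m≤m+n n 9)))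
  where
  search : ∀ j → n ≤ 2 ^ (j + 9) → ∃[ k ] (2 ^ (k + 8) ≤ n × n ≤ 2 ^ (k + 9))
  search zero n≤2⁹ = 0 , 256≤n , n≤2⁹
  search (suc j) n≤2^[j+10] with n ≤? 2 ^ (j + 9)
  ... | yes n≤2^[j+9] = search j n≤2^[j+9]
  ... | no n≰2^[j+9] = suc j , subst (_≤ n) (cong (2 ^_) (+-suc j 8)) (<⇒≤ (≰⇒> n≰2^[j+9])) , n≤2^[j+10]

logBelowRoot-large : ∀ {n} → 256 ≤ n → LogBelowRoot n
logBelowRoot-large {n} 256≤n with dyadicInterval 256≤n
... | k , 2^[k+8]≤n , n≤2^[k+9] =
  k + 9 , 1 , s≤s z≤n , subst (_≤ 2 ^ (k + 9)) (sym (*-identityʳ n)) n≤2^[k+9] , (begin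
    (k + 9) ^ 5                 ≤⟨ [k+9]⁵≤2^[k+8]*2^[k+8] k ⟩
    2 ^ (k + 8) * 2 ^ (k + 8)   ≤⟨ *-mono-≤ 2^[k+8]≤n 2^[k+8]≤n ⟩
    n * n                       ≡⟨ solve 1 (λ n → n :* n := (n :^ 2) :* (con 1 :^ 5)) refl n ⟩
    n ^ 2 * 1 ^ 5               ∎)
  where open ≤-Reasoning

-- Near 132 the margin is thin (log₂ 133 ≈ 7.055, 133^(2/5) ≈ 7.072), hence the large denominators there.
logBelowRoot : ∀ {n} → 132 < n → LogBelowRoot n
logBelowRoot {n} 132<n with n ≤? 134
... | yes n≤134 = logBelowRoot-interval 133 134 99 14 132<n n≤134 (s≤s z≤n) (≤ᵇ⇒≤ _ _ tt) (≤ᵇ⇒≤ _ _ tt)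
... | no n≰134 with n ≤? 138
... | yes n≤138 = logBelowRoot-interval 135 138 64 9 (≰⇒> n≰134) n≤138 (s≤s z≤n) (≤ᵇ⇒≤ _ _ tt) (≤ᵇ⇒≤ _ _ tt)
... | no n≰138 with n ≤? 146
... | yes n≤146 = logBelowRoot-interval 139 146 151 21 (≰⇒> n≰138) n≤146 (s≤s z≤n) (≤ᵇ⇒≤ _ _ tt) (≤ᵇ⇒≤ _ _ tt)
... | no n≰146 with n ≤? 164
... | yes n≤164 = logBelowRoot-interval 147 164 184 25 (≰⇒> n≰146) n≤164 (s≤s z≤n) (≤ᵇ⇒≤ _ _ tt) (≤ᵇ⇒≤ _ _ tt)
... | no n≰164 with n ≤? 209
... | yes n≤209 = logBelowRoot-interval 165 209 185 24 (≰⇒> n≰164) n≤209 (s≤s z≤n) (≤ᵇ⇒≤ _ _ tt) (≤ᵇ⇒≤ _ _ tt)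
... | no n≰209 with n ≤? 255
... | yes n≤255 = logBelowRoot-interval 210 255 8 1 (≰⇒> n≰209) n≤255 (s≤s z≤n) (≤ᵇ⇒≤ _ _ tt) (≤ᵇ⇒≤ _ _ tt)
... | no n≰255 = logBelowRoot-large (≰⇒> n≰255)

¬BigOrder : ∀ {n m} → 132 < n → m ≤ n * n → ¬ BigOrder n m
¬BigOrder {n} {m} 132<n m≤n² (a , b , _ , n²b⁵<a⁵ , 2ᵃnᵇ≤mᵇ) =
  <⇒≱ n²b⁵<a⁵ (2^a≤n^b⇒a⁵≤n²b⁵ {n} {a} {b} (logBelowRoot 132<n) 2ᵃ≤nᵇ)
  where
  open ≤-Reasoning
  instance _ = m^n≢0 n b {{>-nonZero (≤-trans (s≤s z≤n) 132<n)}}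
  2ᵃ≤nᵇ : 2 ^ a ≤ n ^ b
  2ᵃ≤nᵇ = *-cancelʳ-≤ (2 ^ a) (n ^ b) (n ^ b) (begin
    2 ^ a * n ^ b ≤⟨ 2ᵃnᵇ≤mᵇ ⟩
    m ^ b         ≤⟨ ^-monoˡ-≤ b m≤n² ⟩
    (n * n) ^ b   ≡⟨ ^-distribʳ-* n n b ⟩
    n ^ b * n ^ b ∎)

criticalPair-order≤n² : ∀ {n} {G : FinGroup n} {S T} (cp : CriticalPair G S T) → CriticalPair.m cp ≤ n * n
criticalPair-order≤n² {T = HS} cp = twoMinNormal⇒m≤n*n M ι type where open CriticalPair cp
criticalPair-order≤n² {T = HC} cp = twoMinNormal⇒m≤n*n M ι type where open CriticalPair cp

proposition4p2 : (n : ℕ) → 132 < n → (G : FinGroup n) → (S : Subset n)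
    → ¬ (𝒵 G HS S ⊎ 𝒵 G HC S)
proposition4p2 n 132<n G S = [ noCriticalPair , noCriticalPair ]
  where
  noCriticalPair : ∀ {T} → ¬ CriticalPair G S T
  noCriticalPair cp = ¬BigOrder 132<n (criticalPair-order≤n² cp) (CriticalPair.big cp)
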